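{- The modal logic $\mathsf K$ is sound for provability models: for every provability model $\mathcal P$ and every formula $A$ with $\mathsf K\vdash A$, we have $\mathcal P,w\Vdash A$ for all worlds $w$ of $\mathcal P$.
   Context: $\mathsf K$ is the smallest normal modal logic in $\mathcal L_\Box$ (classical tautologies, $\Box(A\to B)\to(\Box A\to\Box B)$, modus ponens, necessitation). Language $\mathcal L_\Box$: formulas built from atomic propositions and $\bot$ using $\to$ and a unary $\Box$. A formula is purely modal if it is a Boolean combination of formulas of the form $\Box B$. A theory is a pair of a set of axioms and a set of inference rules (finitely many premises, one conclusion); $\mathsf T\vdash A$ means derivability from axioms by rules. A theory is classical if modus ponens is one of its rules and all classical tautologies are derivable. A provability pre-model is $\mathcal P=(W,\sqsubset,\{L_w\}_{w\in W^\sqsubset},V)$ with $W$ nonempty, $\sqsubset$ a binary relation on $W$, $V\subseteq W\times\mathrm{atoms}$, $W^\sqsubset=\{u:\exists v\,(v\sqsubset u)\}$, and a theory $L_w$ for each $w\in W^\sqsubset$. Satisfaction: atoms via $V$, $\bot$ never holds, $\to$ classical, $\mathcal P,w\Vdash\Box A$ iff $L_u\vdash A$ for all $u$ with $w\sqsubset u$. With $\sqsubset^+$ the transitive closure, $\mathcal P,w\Vdash^+A$ iff there is $u\sqsubset w$ with $\mathcal P,v\Vdash A$ for all $v$ such that $u\sqsubset^+v$. A provability model is a pre-model in which every $L_w$ is classical and which satisfies modal completeness: for every $w\in W^\sqsubset$ and purely modal $A$, $\mathcal P,w\Vdash^+A$ implies $L_w\vdash A$. -}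

module Defs where

open import Data.Nat using (ℕ)
open import Data.Bool using (Bool; true; false; _∨_; not)
open import Data.List using (List; []; _∷_)
open import Data.List.Relation.Unary.All using (All)
open import Data.Product using (Σ; _×_; ∃)
open import Data.Empty using (⊥)
open import Relation.Binary.PropositionalEquality using (_≡_)
open import Relation.Binary.Construct.Closure.Transitive using (TransClosure)

infixr 5 _⇒_

data Fm : Set where
  var : ℕ → Fm
  bot : Fm
  _⇒_ : Fm → Fm → Fm
  □_  : Fm → Fm

-- Classical (Boolean) evaluation: atoms and □-formulas are treated as
-- propositional variables, valued by v.
evalB : (Fm → Bool) → Fm → Bool
evalB v (var n) = v (var n)
evalB v bot     = false
evalB v (A ⇒ B) = not (evalB v A) ∨ evalB v B
evalB v (□ A)   = v (□ A)

-- A is a classical tautology (substitution instance of a propositional tautology)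
Tautology : Fm → Set
Tautology A = (v : Fm → Bool) → evalB v A ≡ true

data K⊢_ : Fm → Set where
  taut : ∀ {A} → Tautology A → K⊢ A
  axK  : ∀ {A B} → K⊢ (□ (A ⇒ B) ⇒ (□ A ⇒ □ B))
  mp   : ∀ {A B} → K⊢ A → K⊢ (A ⇒ B) → K⊢ B
  nec  : ∀ {A} → K⊢ A → K⊢ (□ A)

data PurelyModal : Fm → Set where
  pm-□   : ∀ B → PurelyModal (□ B)
  pm-bot : PurelyModal bot
  pm-⇒   : ∀ {A B} → PurelyModal A → PurelyModal B → PurelyModal (A ⇒ B)

record Theory : Set₁ where
  field
    Axiom : Fm → Set
    Rule  : List Fm → Fm → Set

data _⊢_ (T : Theory) : Fm → Set where
  ax   : ∀ {A} → Theory.Axiom T A → T ⊢ A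
  rule : ∀ {Ps A} → Theory.Rule T Ps A → All (T ⊢_) Ps → T ⊢ A

record Classical (T : Theory) : Set where
  field
    mp-rule : ∀ A B → Theory.Rule T (A ∷ (A ⇒ B) ∷ []) B
    tauts   : ∀ A → Tautology A → T ⊢ A

-- Provability pre-model.  L is given at every world; only its values on
-- W^⊏ = { u | ∃ v. v ⊏ u } are ever used.
record PreModel : Set₁ where
  field
    W   : Set
    w₀  : W                      -- W is nonempty
    _⊏_ : W → W → Set
    L   : W → Theory
    V   : W → ℕ → Set

  InW⊏ : W → Set
  InW⊏ u = Σ W (λ v → v ⊏ u)

  _⊩_ : W → Fm → Set
  w ⊩ var n = V w n
  w ⊩ bot   = ⊥
  w ⊩ (A ⇒ B) = w ⊩ A → w ⊩ B
  w ⊩ (□ A) = ∀ u → w ⊏ u → L u ⊢ A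

  _⊩⁺_ : W → Fm → Set
  w ⊩⁺ A = Σ W (λ u → u ⊏ w × (∀ v → TransClosure _⊏_ u v → v ⊩ A))

record ProvabilityModel : Set₁ where
  field
    pre : PreModel
  open PreModel pre public
  field
    classical    : ∀ w → InW⊏ w → Classical (L w)
    modal-compl  : ∀ w → InW⊏ w → ∀ A → PurelyModal A → w ⊩⁺ A → L w ⊢ A

-- Soundness is proved simultaneously for truth at every world and for
-- derivability in every theory L u with u ∈ W^⊏.  Tautologies are true at
-- every world because, classically, the truth values of atoms and boxed
-- formulas form a Boolean valuation under which ⊩ is evaluation, and they are
-- derivable since each L u is classical.  A valid formula holds in particular
-- at all ⊏⁺-successors of a predecessor of u, so modal completeness turns the
-- valid purely modal formulas (axiom K and necessitations) into theorems of
-- L u; conversely, derivability in every L u is what makes □ A true.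
module Submission where

open import Defs
open import Axiom.ExcludedMiddle using (ExcludedMiddle)
open import Level using (0ℓ)
open import Data.Bool using (Bool)
open import Data.Product using (_,_)
open import Data.List.Relation.Unary.All using ([]; _∷_)
open import Relation.Binary.PropositionalEquality using (subst)
open import Relation.Nullary using (does; proof)
open import Relation.Nullary.Reflects using (Reflects; invert; ofⁿ; _→-reflects_)

⊢-mp : ∀ {T A B} → Classical T → T ⊢ A → T ⊢ (A ⇒ B) → T ⊢ B
⊢-mp {A = A} {B} cl a a⇒b = rule (Classical.mp-rule cl A B) (a ∷ a⇒b ∷ [])

module _ (P : PreModel) where
  open PreModel P

  valid⇒⊩⁺ : ∀ {u A} → InW⊏ u → (∀ w → w ⊩ A) → u ⊩⁺ A
  valid⇒⊩⁺ (v , v⊏u) valid = v , v⊏u , λ w _ → valid w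

  ⊢-everywhere⇒⊩□ : ∀ {A} → (∀ u → InW⊏ u → L u ⊢ A) → ∀ w → w ⊩ (□ A)
  ⊢-everywhere⇒⊩□ derivable w u w⊏u = derivable u (w , w⊏u)

  module _ (em : ExcludedMiddle 0ℓ) where

    truthValue : W → Fm → Bool
    truthValue w A = does (em {w ⊩ A})

    evalB-truthValue-reflects : ∀ w A → Reflects (w ⊩ A) (evalB (truthValue w) A)
    evalB-truthValue-reflects w (var n) = proof em
    evalB-truthValue-reflects w bot     = ofⁿ λ ()
    evalB-truthValue-reflects w (A ⇒ B) =
      evalB-truthValue-reflects w A →-reflects evalB-truthValue-reflects w B
    evalB-truthValue-reflects w (□ A)   = proof em

    tautology⇒⊩ : ∀ {A} → Tautology A → ∀ w → w ⊩ A
    tautology⇒⊩ {A} tautological w =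
      invert (subst (Reflects _) (tautological (truthValue w)) (evalB-truthValue-reflects w A))

module _ (P : ProvabilityModel) where
  open ProvabilityModel P

  valid-purelyModal⇒⊢ : ∀ {u A} → InW⊏ u → PurelyModal A → (∀ w → w ⊩ A) → L u ⊢ A
  valid-purelyModal⇒⊢ {u} {A} u∈W⊏ modal valid =
    modal-compl u u∈W⊏ A modal (valid⇒⊩⁺ pre {A = A} u∈W⊏ valid)

  ⊩-axK : ∀ {A B} w → w ⊩ (□ (A ⇒ B) ⇒ (□ A ⇒ □ B))
  ⊩-axK w □A⇒B □A u w⊏u = ⊢-mp (classical u (w , w⊏u)) (□A u w⊏u) (□A⇒B u w⊏u)

  module _ (em : ExcludedMiddle 0ℓ) where

    K-sound : ∀ {A} → K⊢ A → ∀ w → w ⊩ A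
    K-sound-⊢ : ∀ {A} → K⊢ A → ∀ u → InW⊏ u → L u ⊢ A

    K-sound {A} (taut t)   = tautology⇒⊩ pre em {A} t
    K-sound axK            = ⊩-axK
    K-sound (mp a a⇒b) w   = K-sound a⇒b w (K-sound a w)
    K-sound (nec a)        = ⊢-everywhere⇒⊩□ pre (K-sound-⊢ a)

    K-sound-⊢ {A} (taut t) u u∈W⊏ = Classical.tauts (classical u u∈W⊏) A t
    K-sound-⊢ axK u u∈W⊏ =
      valid-purelyModal⇒⊢ u∈W⊏ (pm-⇒ (pm-□ _) (pm-⇒ (pm-□ _) (pm-□ _))) ⊩-axK
    K-sound-⊢ (mp a a⇒b) u u∈W⊏ =
      ⊢-mp (classical u u∈W⊏) (K-sound-⊢ a u u∈W⊏) (K-sound-⊢ a⇒b u u∈W⊏)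
    K-sound-⊢ {□ A} (nec a) u u∈W⊏ =
      valid-purelyModal⇒⊢ u∈W⊏ (pm-□ A) (⊢-everywhere⇒⊩□ pre (K-sound-⊢ a))

theorem3p6 : ExcludedMiddle 0ℓ → (P : ProvabilityModel) → ∀ A → K⊢ A → ∀ w → ProvabilityModel._⊩_ P w A
theorem3p6 em P A = K-sound P em
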